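{- Let $\pi$ be a simple permutation of length $n\ge 4$ avoiding both $2143$ and $4231$, whose leftmost, rightmost, highest and lowest points form the pattern $2413$. Then $\sigma=\pi^{ -1}$ has the following form. Let $\ell=(1,\sigma(1))$, $r=(n,\sigma(n))$, $u=(p_u,n)$ the highest and $d=(p_d,1)$ the lowest point of $\sigma$ (these form the pattern $3142$, so $1<p_d<p_u<n$ and $1<\sigma(n)<\sigma(1)<n$), and define regions $A$: $1<i<p_d$, $\sigma(1)<\sigma(i)<n$; $B$: $p_d<i<p_u$, $\sigma(1)<\sigma(i)<n$; $C$: $1<i<p_d$, $\sigma(n)<\sigma(i)<\sigma(1)$; $D$: $p_d<i<p_u$, $\sigma(n)<\sigma(i)<\sigma(1)$; $E$: $p_u<i<n$, $\sigma(n)<\sigma(i)<\sigma(1)$; $F$: $p_d<i<p_u$, $1<\sigma(i)<\sigma(n)$; $G$: $p_u<i<n$, $1<\sigma(i)<\sigma(n)$. Then every point of $\sigma$ other than $\ell,r,u,d$ lies in $A\cup B\cup D\cup F\cup G$ (so $C$ and $E$ are empty); $B\cup\{u\}$ is increasing; $D$ is decreasing; $F\cup\{d\}$ is increasing; $A$ has at most one point, whose value (if it exists) lies strictly between the smallest and second smallest values of $B\cup\{u\}$; $G$ has at most one point, whose value (if it exists) lies strictly between the second largest and the largest values of $F\cup\{d\}$. The cells $A$ and $G$ may be empty.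
   Context: A permutation of length $n$ is an arrangement $\pi(1)\cdots\pi(n)$ of $1,\dots,n$, viewed as points $(i,\pi(i))$; $\pi^{ -1}$ is the inverse permutation. $\pi$ is contained in $\sigma$ if some subsequence of $\sigma$ is in the same relative order as $\pi$; otherwise $\sigma$ avoids $\pi$. A set of points forms pattern $\tau$ if, read left to right, their values are in the same relative order as $\tau$. An interval is a set of contiguous entries whose values form a set of consecutive integers; trivial if of size $1$ or the whole permutation. A permutation is simple if all its intervals are trivial. -}

module Defs where

open import Data.Nat using (ℕ; zero; suc; _≤_; _<_; _∸_)
open import Data.Fin using (Fin; toℕ)
open import Data.Fin.Permutation using (Permutation′; _⟨$⟩ʳ_; _⟨$⟩ˡ_)
open import Data.Vec using (_∷_; []; lookup)
open import Data.Product using (Σ; _×_; ∃; ∃-syntax)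
open import Data.Sum using (_⊎_)
open import Relation.Binary.PropositionalEquality using (_≡_; _≢_)
open import Relation.Nullary using (¬_)

-- Conventions: positions and values are 0-indexed (Fin n); the point of a
-- permutation f at position i is (i , f i).  Paper's position/value k is our k-1.

perm : ∀ {n} → Permutation′ n → Fin n → Fin n
perm π i = π ⟨$⟩ʳ i

inv : ∀ {n} → Permutation′ n → Fin n → Fin n
inv π i = π ⟨$⟩ˡ i

StrictlyIncreasing : ∀ {k n} → (Fin k → Fin n) → Set
StrictlyIncreasing p = ∀ i j → toℕ i < toℕ j → toℕ (p i) < toℕ (p j)

SameOrder : ∀ {k n} → (Fin n → Fin n) → (Fin k → Fin n) → (Fin k → ℕ) → Set
SameOrder f p τ = ∀ i j →
  (toℕ (f (p i)) < toℕ (f (p j)) → τ i < τ j) × (τ i < τ j → toℕ (f (p i)) < toℕ (f (p j)))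

Contains : ∀ {k n} → (Fin n → Fin n) → (Fin k → ℕ) → Set
Contains {k} {n} f τ = Σ (Fin k → Fin n) λ p → StrictlyIncreasing p × SameOrder f p τ

Avoids : ∀ {k n} → (Fin n → Fin n) → (Fin k → ℕ) → Set
Avoids f τ = ¬ Contains f τ

pat2143 pat4231 pat2413 : Fin 4 → ℕ
pat2143 = lookup (2 ∷ 1 ∷ 4 ∷ 3 ∷ [])
pat4231 = lookup (4 ∷ 2 ∷ 3 ∷ 1 ∷ [])
pat2413 = lookup (2 ∷ 4 ∷ 1 ∷ 3 ∷ [])

-- The set of points at positions {x₁,x₂,x₃,x₄} of f, read left to right,
-- forms the pattern τ (of length 4).
FourPointsForm : ∀ {n} → (Fin n → Fin n) → (x₁ x₂ x₃ x₄ : Fin n) → (Fin 4 → ℕ) → Set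
FourPointsForm {n} f x₁ x₂ x₃ x₄ τ = Σ (Fin 4 → Fin n) λ p →
  StrictlyIncreasing p
  × (∀ i → p i ≡ x₁ ⊎ p i ≡ x₂ ⊎ p i ≡ x₃ ⊎ p i ≡ x₄)
  × (∃[ i ] p i ≡ x₁) × (∃[ i ] p i ≡ x₂) × (∃[ i ] p i ≡ x₃) × (∃[ i ] p i ≡ x₄)
  × SameOrder f p τ

IsInterval : ∀ {n} → (Fin n → Fin n) → ℕ → ℕ → Set
IsInterval {n} f a b = ∀ (i j v : Fin n) →
  a ≤ toℕ i → toℕ i ≤ b → a ≤ toℕ j → toℕ j ≤ b →
  toℕ (f i) ≤ toℕ v → toℕ v ≤ toℕ (f j) →
  ∃[ k ] (a ≤ toℕ k × toℕ k ≤ b × f k ≡ v)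

Simple : ∀ {n} → (Fin n → Fin n) → Set
Simple {n} f = ∀ a b → a ≤ b → b < n → IsInterval f a b →
  a ≡ b ⊎ (a ≡ 0 × b ≡ n ∸ 1)

-- Regions of σ, given s₁ = σ(first), sₙ = σ(last), pd = position of lowest,
-- pu = position of highest (all 0-indexed).
module Regions {n : ℕ} (σ : Fin n → Fin n) (s₁ sₙ pd pu : ℕ) where
  v : Fin n → ℕ
  v i = toℕ (σ i)

  InA InB InC InD InE InF InG BU Fd : Fin n → Set
  InA i = 0 < toℕ i × toℕ i < pd × s₁ < v i × v i < n ∸ 1
  InB i = pd < toℕ i × toℕ i < pu × s₁ < v i × v i < n ∸ 1
  InC i = 0 < toℕ i × toℕ i < pd × sₙ < v i × v i < s₁
  InD i = pd < toℕ i × toℕ i < pu × sₙ < v i × v i < s₁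
  InE i = pu < toℕ i × toℕ i < n ∸ 1 × sₙ < v i × v i < s₁
  InF i = pd < toℕ i × toℕ i < pu × 0 < v i × v i < sₙ
  InG i = pu < toℕ i × toℕ i < n ∸ 1 × 0 < v i × v i < sₙ
  BU i = InB i ⊎ toℕ i ≡ pu
  Fd i = InF i ⊎ toℕ i ≡ pd

  IncreasingOn DecreasingOn : (Fin n → Set) → Set
  IncreasingOn S = ∀ i j → S i → S j → toℕ i < toℕ j → v i < v j
  DecreasingOn S = ∀ i j → S i → S j → toℕ i < toℕ j → v j < v i

  AtMostOne : (Fin n → Set) → Set
  AtMostOne S = ∀ i j → S i → S j → i ≡ j

  BetweenTwoSmallest : (Fin n → Set) → ℕ → Set
  BetweenTwoSmallest S x = ∃[ j ] ∃[ k ] (S j × S k × j ≢ k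
    × (∀ m → S m → v j ≤ v m)
    × (∀ m → S m → m ≢ j → v k ≤ v m)
    × v j < x × x < v k)

  BetweenTwoLargest : (Fin n → Set) → ℕ → Set
  BetweenTwoLargest S x = ∃[ j ] ∃[ k ] (S j × S k × j ≢ k
    × (∀ m → S m → v m ≤ v j)
    × (∀ m → S m → m ≢ j → v m ≤ v k)
    × v k < x × x < v j)

  Shape : Set
  Shape =
    (0 < pd × pd < pu × pu < n ∸ 1 × 0 < sₙ × sₙ < s₁ × s₁ < n ∸ 1)
    × (∀ i → toℕ i ≢ 0 → toℕ i ≢ n ∸ 1 → toℕ i ≢ pu → toℕ i ≢ pd →
         InA i ⊎ InB i ⊎ InD i ⊎ InF i ⊎ InG i)
    × (∀ i → ¬ InC i) × (∀ i → ¬ InE i)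
    × IncreasingOn BU
    × DecreasingOn InD
    × IncreasingOn Fd
    × AtMostOne InA × (∀ i → InA i → BetweenTwoSmallest BU (v i))
    × AtMostOne InG × (∀ i → InG i → BetweenTwoLargest Fd (v i))

-- The inverse σ = π⁻¹ again avoids 2143 and 4231 (both patterns are involutions), and the
-- intervals of π are exactly the blocks of σ: rectangles [p,q) × [a,b) of the plot of σ whose
-- columns [p,q) and rows [a,b) contain the same points.  So every block of σ with two points is
-- the whole plot.  Avoidance alone places every point in A ∪ C ∪ B ∪ D ∪ F ∪ E ∪ G and makes
-- B ∪ {u}, F ∪ {d} increasing and D decreasing.  Each remaining claim is proved by exhibiting a
-- block with two points that stops short of a side of the plot, spanned by an extremal point of
-- the offending configuration (a point of C, the highest point of A, the rightmost point of A
-- below the lowest point of B ∪ {u}, ...) and the corner ℓ or r, or by two points of A or of G.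

module Submission where

open import Defs
open import Data.Nat using (ℕ; zero; suc; _≤_; _<_; _∸_; z≤n; s≤s; s≤s⁻¹; _<?_; _≤?_; _≟_)
open import Data.Nat.Properties
open import Data.Fin using (Fin; toℕ; zero; suc; fromℕ; inject₁; #_)
open import Data.Fin.Properties using (toℕ-injective; toℕ<n; toℕ≤pred[n]; toℕ-fromℕ; all?; any?)
  renaming (_≟_ to _≟ᶠ_)
open import Data.Fin.Permutation using (Permutation′; inverseˡ; inverseʳ)
open import Data.List using (List; filter; allFin)
open import Data.List.Extrema.Nat using (argmin; argmax; argmin-all; argmax-all; f[argmin]≤f[xs]; f[xs]≤f[argmax])
open import Data.List.Membership.Propositional using (_∈_)
open import Data.List.Membership.Propositional.Properties using (∈-filter⁺; ∈-allFin)
import Data.List.Relation.Unary.All as All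
open import Data.List.Relation.Unary.All.Properties using (all-filter)
open import Data.Vec using (_∷_; []; lookup)
open import Data.Product using (Σ; ∃; _×_; _,_; proj₁; proj₂)
open import Data.Sum using (_⊎_; inj₁; inj₂)
open import Data.Empty using (⊥; ⊥-elim)
open import Function using (id; _∘_)
open import Relation.Binary using (tri<; tri≈; tri>)
open import Relation.Binary.PropositionalEquality
open import Relation.Nullary using (Dec; yes; no; ¬_; ¬?)
open import Relation.Nullary.Decidable using (True; toWitness; _→-dec_; _×-dec_; _⊎-dec_)
open import Relation.Unary using (Decidable)

Ascending : ∀ {k} → (Fin k → ℕ) → Set
Ascending g = ∀ i j → toℕ i < toℕ j → g i < g j

ascending? : ∀ {k} (g : Fin k → ℕ) → Dec (Ascending g)
ascending? g = all? λ i → all? λ j → (toℕ i <? toℕ j) →-dec (g i <? g j)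

ascending-by-steps : ∀ {k} (g : Fin (suc k) → ℕ) → (∀ i → g (inject₁ i) < g (suc i)) → Ascending g
ascending-by-steps g step zero (suc zero) _ = step zero
ascending-by-steps {suc k} g step zero (suc (suc j)) _ =
  <-trans (step zero) (ascending-by-steps (g ∘ suc) (step ∘ suc) zero (suc j) (s≤s z≤n))
ascending-by-steps {suc k} g step (suc i) (suc j) (s≤s i<j) = ascending-by-steps (g ∘ suc) (step ∘ suc) i j i<j

ascending₄ : (g : Fin 4 → ℕ) → g zero < g (# 1) → g (# 1) < g (# 2) → g (# 2) < g (# 3) → Ascending g
ascending₄ g s₀ s₁ s₂ = ascending-by-steps g λ { zero → s₀ ; (suc zero) → s₁ ; (suc (suc zero)) → s₂ }

ascending⇒order-agrees : ∀ {k} (ρ : Fin k → Fin k) → (∀ i → ∃ λ a → ρ a ≡ i) →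
  (g h : Fin k → ℕ) → Ascending (g ∘ ρ) → Ascending (h ∘ ρ) → ∀ i j → g i < g j → h i < h j
ascending⇒order-agrees ρ onto g h g↑ h↑ i j gi<gj with onto i | onto j
... | a , refl | b , refl with <-cmp (toℕ a) (toℕ b)
... | tri< a<b _ _ = h↑ a b a<b
... | tri≈ _ a≡b _ = ⊥-elim (<-irrefl (cong (g ∘ ρ) (toℕ-injective a≡b)) gi<gj)
... | tri> _ _ b<a = ⊥-elim (<-asym gi<gj (g↑ b a b<a))

sameOrder-by-sorting : ∀ {k n} (τ : Fin k → ℕ) (ρ : Fin k → Fin k) (f : Fin n → Fin n) (p : Fin k → Fin n)
  {ρ-onto : True (all? λ i → any? λ a → ρ a ≟ᶠ i)} {τρ-ascending : True (ascending? (τ ∘ ρ))} →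
  Ascending (λ i → toℕ (f (p (ρ i)))) → SameOrder f p τ
sameOrder-by-sorting τ ρ f p {ρ-onto} {τρ-ascending} fpρ-ascending i j =
    agrees F τ fpρ-ascending (toWitness τρ-ascending) i j
  , agrees τ F (toWitness τρ-ascending) fpρ-ascending i j
  where
  F : Fin _ → ℕ
  F i = toℕ (f (p i))
  agrees = ascending⇒order-agrees ρ (toWitness ρ-onto)

-- Listing points of inv π by increasing value lists points of π by increasing position.
contains-via-inverse : ∀ {k n} (π : Permutation′ n) (τ : Fin k → ℕ) (q : Fin k → Fin n) →
  Ascending (λ i → toℕ (inv π (q i))) → SameOrder id q τ → Contains (perm π) τ
contains-via-inverse π τ q σq-ascending q≈τ = (λ i → inv π (q i)) , σq-ascending , same
  where
  same : SameOrder (perm π) (λ i → inv π (q i)) τ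
  same i j rewrite inverseʳ π {q i} | inverseʳ π {q j} = q≈τ i j

peak-unique : ∀ {k} (g : Fin k → ℕ) (j : Fin k) → (∀ i → i ≢ j → g i < g j) →
  ∀ i → g j ≤ g i → i ≡ j
peak-unique g j peak i gj≤gi with i ≟ᶠ j
... | yes i≡j = i≡j
... | no i≢j = ⊥-elim (<⇒≱ (peak i i≢j) gj≤gi)

valley-unique : ∀ {k} (g : Fin k → ℕ) (j : Fin k) → (∀ i → i ≢ j → g j < g i) →
  ∀ i → g i ≤ g j → i ≡ j
valley-unique g j valley i gi≤gj with i ≟ᶠ j
... | yes i≡j = i≡j
... | no i≢j = ⊥-elim (<⇒≱ (valley i i≢j) gi≤gj)

module Extremal {n} (f : Fin n → ℕ) {Q : Fin n → Set} (Q? : Decidable Q) where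
  private
    candidates : List (Fin n)
    candidates = filter Q? (allFin n)

    candidate : ∀ {m} → Q m → m ∈ candidates
    candidate Qm = ∈-filter⁺ Q? (∈-allFin _) Qm

  minimiser : ∀ i → Q i → Σ (Fin n) λ k → Q k × (∀ m → Q m → f k ≤ f m)
  minimiser i Qi = argmin f i candidates , argmin-all f Qi (all-filter Q? (allFin n))
                 , λ m Qm → All.lookup (f[argmin]≤f[xs] i candidates) (candidate Qm)

  maximiser : ∀ i → Q i → Σ (Fin n) λ k → Q k × (∀ m → Q m → f m ≤ f k)
  maximiser i Qi = argmax f i candidates , argmax-all f Qi (all-filter Q? (allFin n))
                 , λ m Qm → All.lookup (f[xs]≤f[argmax] i candidates) (candidate Qm)

corners-of-2413 : ∀ {N} (f : Fin (suc N) → Fin (suc N)) (x₁ x₂ x₃ x₄ : Fin (suc N)) →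
  toℕ x₁ ≡ 0 → toℕ x₂ ≡ N → toℕ (f x₃) ≡ N → toℕ (f x₄) ≡ 0 →
  FourPointsForm f x₁ x₂ x₃ x₄ pat2413 →
  (toℕ x₁ < toℕ x₃ × toℕ x₃ < toℕ x₄ × toℕ x₄ < toℕ x₂)
  × (toℕ (f x₄) < toℕ (f x₁) × toℕ (f x₁) < toℕ (f x₂) × toℕ (f x₂) < toℕ (f x₃))
corners-of-2413 {N} f x₁ x₂ x₃ x₄ x₁-left x₂-right x₃-top x₄-bottom
  (p , p-ascending , _ , (k₁ , pk₁≡x₁) , (k₂ , pk₂≡x₂) , (k₃ , pk₃≡x₃) , (k₄ , pk₄≡x₄) , same)
  = (moved p₀ p₁ (position zero (# 1)) , moved p₁ p₂ (position (# 1) (# 2)) , moved p₂ p₃ (position (# 2) (# 3)))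
  , (moved p₂ p₀ (value (# 2) zero) , moved p₀ p₃ (value zero (# 3)) , moved p₃ p₁ (value (# 3) (# 1)))
  where
  P F : Fin 4 → ℕ
  P i = toℕ (p i)
  F i = toℕ (f (p i))

  position : ∀ i j {ok : True (toℕ i <? toℕ j)} → P i < P j
  position i j {ok} = p-ascending i j (toWitness ok)

  value : ∀ i j {ok : True (pat2413 i <? pat2413 j)} → F i < F j
  value i j {ok} = proj₂ (same i j) (toWitness ok)

  P-valley : ∀ i → i ≢ zero → P zero < P i
  P-valley i i≢0 = p-ascending zero i (toWitness {a? = all? λ i → ¬? (i ≟ᶠ zero) →-dec (0 <? toℕ i)} _ i i≢0)

  P-peak : ∀ i → i ≢ # 3 → P i < P (# 3)
  P-peak i i≢3 = p-ascending i (# 3) (toWitness {a? = all? λ i → ¬? (i ≟ᶠ # 3) →-dec (toℕ i <? 3)} _ i i≢3)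

  F-peak : ∀ i → i ≢ # 1 → F i < F (# 1)
  F-peak i i≢1 =
    proj₂ (same i (# 1)) (toWitness {a? = all? λ i → ¬? (i ≟ᶠ # 1) →-dec (pat2413 i <? 4)} _ i i≢1)

  F-valley : ∀ i → i ≢ # 2 → F (# 2) < F i
  F-valley i i≢2 =
    proj₂ (same (# 2) i) (toWitness {a? = all? λ i → ¬? (i ≟ᶠ # 2) →-dec (1 <? pat2413 i)} _ i i≢2)

  moved : ∀ {g : Fin (suc N) → ℕ} {i j x y} → p i ≡ x → p j ≡ y → g (p i) < g (p j) → g x < g y
  moved refl refl lt = lt

  bottom-at : ∀ (g : Fin 4 → ℕ) j → (∀ i → i ≢ j → g j < g i) →
    ∀ {k x} → p k ≡ x → g k ≡ 0 → p j ≡ x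
  bottom-at g j valley {k} pk≡x gk≡0 with valley-unique g j valley k (subst (_≤ g j) (sym gk≡0) z≤n)
  ... | refl = pk≡x

  top-at : ∀ (g : Fin 4 → ℕ) → (∀ i → g i ≤ N) → ∀ j → (∀ i → i ≢ j → g i < g j) →
    ∀ {k x} → p k ≡ x → g k ≡ N → p j ≡ x
  top-at g g≤N j peak {k} pk≡x gk≡N with peak-unique g j peak k (subst (g j ≤_) (sym gk≡N) (g≤N j))
  ... | refl = pk≡x

  -- The positions peak at index 3 and bottom at 0; the values of 2413 peak at 1 and bottom at 2.
  p₀ : p zero ≡ x₁
  p₀ = bottom-at P zero P-valley pk₁≡x₁ (trans (cong toℕ pk₁≡x₁) x₁-left)

  p₁ : p (# 1) ≡ x₃
  p₁ = top-at F (λ i → toℕ≤pred[n] (f (p i))) (# 1) F-peak pk₃≡x₃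
         (trans (cong (toℕ ∘ f) pk₃≡x₃) x₃-top)

  p₂ : p (# 2) ≡ x₄
  p₂ = bottom-at F (# 2) F-valley pk₄≡x₄ (trans (cong (toℕ ∘ f) pk₄≡x₄) x₄-bottom)

  p₃ : p (# 3) ≡ x₂
  p₃ = top-at P (λ i → toℕ≤pred[n] (p i)) (# 3) P-peak pk₂≡x₂ (trans (cong toℕ pk₂≡x₂) x₂-right)

record IsBlock {n} (σ : Fin n → Fin n) (p q a b : ℕ) : Set where
  field
    values-of-positions : ∀ i → p ≤ toℕ i → toℕ i < q → a ≤ toℕ (σ i) × toℕ (σ i) < b
    positions-of-values : ∀ i → a ≤ toℕ (σ i) → toℕ (σ i) < b → p ≤ toℕ i × toℕ i < q

module Inverse {N : ℕ} (π : Permutation′ (suc N)) where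
  σ : Fin (suc N) → Fin (suc N)
  σ = inv π

  v : Fin (suc N) → ℕ
  v i = toℕ (σ i)

  v-injective : ∀ {i j} → v i ≡ v j → i ≡ j
  v-injective {i} {j} vi≡vj = begin
    i                ≡⟨ inverseʳ π ⟨
    perm π (σ i)     ≡⟨ cong (perm π) (toℕ-injective vi≡vj) ⟩
    perm π (σ j)     ≡⟨ inverseʳ π ⟩
    j                ∎
    where open ≡-Reasoning

  v≤N : ∀ i → v i ≤ N
  v≤N i = toℕ≤pred[n] (σ i)

  πσ≡id : ∀ {i} → toℕ (perm π (σ i)) ≡ toℕ i
  πσ≡id = cong toℕ (inverseʳ π)

  σπ≡id : ∀ {i} → v (perm π i) ≡ toℕ i
  σπ≡id = cong toℕ (inverseˡ π)

  -- q lists the four points by increasing value; the permutation of indices passed to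
  -- sameOrder-by-sorting lists them by increasing position.
  no-2143 : Avoids (perm π) pat2143 → ∀ a b c e → toℕ a < toℕ b → toℕ b < toℕ c → toℕ c < toℕ e →
    v b < v a → v a < v e → v e < v c → ⊥
  no-2143 avoids a b c e a<b b<c c<e vb<va va<ve ve<vc = avoids
    (contains-via-inverse π pat2143 q (ascending₄ (λ i → toℕ (σ (q i))) vb<va va<ve ve<vc)
      (sameOrder-by-sorting pat2143 (lookup (# 1 ∷ # 0 ∷ # 3 ∷ # 2 ∷ [])) id q
        (ascending₄ (λ i → toℕ (q (lookup (# 1 ∷ # 0 ∷ # 3 ∷ # 2 ∷ []) i))) a<b b<c c<e)))
    where
    q : Fin 4 → Fin (suc N)
    q = lookup (b ∷ a ∷ e ∷ c ∷ [])

  no-4231 : Avoids (perm π) pat4231 → ∀ a b c e → toℕ a < toℕ b → toℕ b < toℕ c → toℕ c < toℕ e →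
    v e < v b → v b < v c → v c < v a → ⊥
  no-4231 avoids a b c e a<b b<c c<e ve<vb vb<vc vc<va = avoids
    (contains-via-inverse π pat4231 q (ascending₄ (λ i → toℕ (σ (q i))) ve<vb vb<vc vc<va)
      (sameOrder-by-sorting pat4231 (lookup (# 3 ∷ # 1 ∷ # 2 ∷ # 0 ∷ [])) id q
        (ascending₄ (λ i → toℕ (q (lookup (# 3 ∷ # 1 ∷ # 2 ∷ # 0 ∷ []) i))) a<b b<c c<e)))
    where
    q : Fin 4 → Fin (suc N)
    q = lookup (e ∷ b ∷ c ∷ a ∷ [])

  -- A block of σ is an interval of π, read with positions and values exchanged.
  block⇒interval : ∀ {p q a b} → IsBlock σ p q a (suc b) → IsInterval (perm π) a b
  block⇒interval {p} {q} {a} {b} block i j w a≤i i≤b a≤j j≤b πi≤w w≤πj =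
    σ w , proj₁ (values-of-positions w p≤w w<q) , s≤s⁻¹ (proj₂ (values-of-positions w p≤w w<q)) , inverseʳ π
    where
    open IsBlock block
    position-of : ∀ k → a ≤ toℕ k → toℕ k ≤ b → p ≤ toℕ (perm π k) × toℕ (perm π k) < q
    position-of k a≤k k≤b = positions-of-values (perm π k)
      (subst (a ≤_) (sym σπ≡id) a≤k)
      (subst (_< suc b) (sym σπ≡id) (s≤s k≤b))
    p≤w : p ≤ toℕ w
    p≤w = ≤-trans (proj₁ (position-of i a≤i i≤b)) πi≤w
    w<q : toℕ w < q
    w<q = ≤-<-trans w≤πj (proj₂ (position-of j a≤j j≤b))

  block-is-whole : Simple (perm π) → ∀ {p q a b} → IsBlock σ p q a b → b ≤ suc N →
    ∀ (x y : Fin (suc N)) → x ≢ y → p ≤ toℕ x → toℕ x < q → p ≤ toℕ y → toℕ y < q → p ≡ 0 × N < q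
  block-is-whole simple {b = zero} block _ x y _ px xq _ _ =
    ⊥-elim (n≮0 (proj₂ (IsBlock.values-of-positions block x px xq)))
  block-is-whole simple {p} {q} {a} {suc b} block b<n x y x≢y px xq py yq
    with simple a b (s≤s⁻¹ (≤-<-trans a≤vx vx<b)) b<n (block⇒interval block)
    where
    open IsBlock block
    a≤vx : a ≤ v x
    a≤vx = proj₁ (values-of-positions x px xq)
    vx<b : v x < suc b
    vx<b = proj₂ (values-of-positions x px xq)
  ... | inj₁ refl = ⊥-elim (x≢y (v-injective (trans (at-bottom x px xq) (sym (at-bottom y py yq)))))
    where
    at-bottom : ∀ z → p ≤ toℕ z → toℕ z < q → v z ≡ a
    at-bottom z pz zq with IsBlock.values-of-positions block z pz zq
    ... | a≤vz , vz<sa = ≤-antisym (s≤s⁻¹ vz<sa) a≤vz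
  ... | inj₂ (refl , refl) =
      n≤0⇒n≡0 (proj₁ (positions-of-values zero z≤n (toℕ<n (σ zero))))
    , subst (_< q) (toℕ-fromℕ N) (proj₂ (positions-of-values (fromℕ N) z≤n (toℕ<n (σ (fromℕ N)))))
    where open IsBlock block

  corners-3142 :
    ((l r u d : Fin (suc N)) → toℕ l ≡ 0 → toℕ r ≡ N →
      toℕ (perm π u) ≡ N → toℕ (perm π d) ≡ 0 → FourPointsForm (perm π) l r u d pat2413) →
    ∀ l r u d → toℕ l ≡ 0 → toℕ r ≡ N → v u ≡ N → v d ≡ 0 →
    (toℕ l < toℕ d × toℕ d < toℕ u × toℕ u < toℕ r) × (v d < v r × v r < v l × v l < v u)
  corners-3142 corners l r u d l-left r-right u-top d-bottom
    with σ-inverse d l (trans d-bottom (sym l-left)) | σ-inverse u r (trans u-top (sym r-right))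
       | corners-of-2413 (perm π) l r (σ r) (σ l) l-left r-right πσr≡N πσl≡0
           (corners l r (σ r) (σ l) l-left r-right πσr≡N πσl≡0)
    where
    σ-inverse : ∀ x y → v x ≡ toℕ y → x ≡ perm π y
    σ-inverse x y vx≡y = trans (sym (inverseʳ π)) (cong (perm π) (toℕ-injective vx≡y))
    πσr≡N : toℕ (perm π (σ r)) ≡ N
    πσr≡N = trans πσ≡id r-right
    πσl≡0 : toℕ (perm π (σ l)) ≡ 0
    πσl≡0 = trans πσ≡id l-left
  ... | refl | refl | (l<σr , σr<σl , σl<r) , (πσl<πl , πl<πr , πr<πσr) =
      (subst (_< toℕ (perm π l)) πσ≡id πσl<πl , πl<πr , subst (toℕ (perm π r) <_) πσ≡id πr<πσr)
    , (subst (_< v r) (sym σπ≡id) l<σr , σr<σl , subst (v l <_) (sym σπ≡id) σl<r)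

module Cells {N : ℕ} (π : Permutation′ (suc N)) (simple : Simple (perm π))
  (avoids-2143 : Avoids (perm π) pat2143) (avoids-4231 : Avoids (perm π) pat4231)
  (l r u d : Fin (suc N))
  (l-left : toℕ l ≡ 0) (r-right : toℕ r ≡ N) (u-top : toℕ (inv π u) ≡ N) (d-bottom : toℕ (inv π d) ≡ 0)
  (l<d : toℕ l < toℕ d) (d<u : toℕ d < toℕ u) (u<r : toℕ u < toℕ r)
  (vd<vr : toℕ (inv π d) < toℕ (inv π r)) (vr<vl : toℕ (inv π r) < toℕ (inv π l))
  (vl<vu : toℕ (inv π l) < toℕ (inv π u))
  where

  open Inverse π
  open Regions σ (v l) (v r) (toℕ d) (toℕ u) hiding (v)

  private variable
    i j : Fin (suc N)

  ≢-by-position : toℕ i < toℕ j → i ≢ j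
  ≢-by-position i<j refl = <-irrefl refl i<j

  ≢-by-value : v i < v j → i ≢ j
  ≢-by-value vi<vj refl = <-irrefl refl vi<vj

  position≤N : (i : Fin (suc N)) → toℕ i ≤ N
  position≤N = toℕ≤pred[n]

  l-unique : toℕ i ≡ 0 → i ≡ l
  l-unique i≡0 = toℕ-injective (trans i≡0 (sym l-left))

  r-unique : toℕ i ≡ N → i ≡ r
  r-unique i≡N = toℕ-injective (trans i≡N (sym r-right))

  u-unique : v i ≡ N → i ≡ u
  u-unique vi≡N = v-injective (trans vi≡N (sym u-top))

  d-unique : v i ≡ 0 → i ≡ d
  d-unique vi≡0 = v-injective (trans vi≡0 (sym d-bottom))

  right-of-l : i ≢ l → 0 < toℕ i
  right-of-l i≢l = n≢0⇒n>0 (λ i≡0 → i≢l (l-unique i≡0))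

  left-of-r : i ≢ r → toℕ i < N
  left-of-r {i = i} i≢r = ≤∧≢⇒< (position≤N i) (λ i≡N → i≢r (r-unique i≡N))

  above-d : i ≢ d → 0 < v i
  above-d i≢d = n≢0⇒n>0 (λ vi≡0 → i≢d (d-unique vi≡0))

  below-u : i ≢ u → v i < N
  below-u {i = i} i≢u = ≤∧≢⇒< (v≤N i) (λ vi≡N → i≢u (u-unique vi≡N))

  from-left : 0 < toℕ i → toℕ l < toℕ i
  from-left = subst (_< _) (sym l-left)

  to-right : toℕ i < N → toℕ i < toℕ r
  to-right = subst (_ <_) (sym r-right)

  from-bottom : 0 < v i → v d < v i
  from-bottom = subst (_< _) (sym d-bottom)

  to-top : v i < N → v i < v u
  to-top = subst (_ <_) (sym u-top)

  0<d : 0 < toℕ d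
  0<d = subst (_< toℕ d) l-left l<d

  u<N : toℕ u < N
  u<N = subst (toℕ u <_) r-right u<r

  0<vr : 0 < v r
  0<vr = subst (_< v r) d-bottom vd<vr

  vl<N : v l < N
  vl<N = subst (v l <_) u-top vl<vu

  left-strip-above-r : ∀ i → 0 < toℕ i → toℕ i < toℕ d → v r < v i
  left-strip-above-r i 0<i i<d with <-cmp (v r) (v i)
  ... | tri< vr<vi _ _ = vr<vi
  ... | tri≈ _ vr≡vi _ =
        ⊥-elim (<⇒≱ (<-trans i<d (<-trans d<u u<r)) (≤-reflexive (cong toℕ (v-injective vr≡vi))))
  ... | tri> _ _ vi<vr = ⊥-elim (no-2143 avoids-2143 i d u r i<d d<u u<r
        (from-bottom (above-d (≢-by-position i<d))) vi<vr (<-trans vr<vl vl<vu))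

  right-strip-below-l : ∀ i → toℕ u < toℕ i → toℕ i < N → v i < v l
  right-strip-below-l i u<i i<N with <-cmp (v i) (v l)
  ... | tri< vi<vl _ _ = vi<vl
  ... | tri≈ _ vi≡vl _ = ⊥-elim (n≮0 (subst (toℕ u <_) (trans (cong toℕ (v-injective vi≡vl)) l-left) u<i))
  ... | tri> _ _ vl<vi = ⊥-elim (no-2143 avoids-2143 l d u i l<d d<u u<i
        (<-trans vd<vr vr<vl) vl<vi (to-top (below-u (≢-sym (≢-by-position u<i)))))

  band-decreasing : toℕ i < toℕ j → v r < v i → v i < v l → v r < v j → v j < v l → v j < v i
  band-decreasing {i = i} {j = j} i<j vr<vi vi<vl vr<vj vj<vl with <-cmp (v i) (v j)
  ... | tri> _ _ vj<vi = vj<vi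
  ... | tri≈ _ vi≡vj _ = ⊥-elim (≢-by-position i<j (v-injective vi≡vj))
  ... | tri< vi<vj _ _ = ⊥-elim (no-4231 avoids-4231 l i j r
        (from-left (right-of-l (≢-by-value vi<vl))) i<j (to-right (left-of-r (≢-sym (≢-by-value vr<vj))))
        vr<vi vi<vj vj<vl)

  C-empty : ∀ k → ¬ InC k
  C-empty k (0<k , k<d , vr<vk , vk<vl) with Extremal.maximiser v (λ i → toℕ i ≤? toℕ k) k ≤-refl
  ... | m , m≤k , m-highest =
    <⇒≱ (<-trans k<d (<-trans d<u u<N)) (s≤s⁻¹ (proj₂ (block-is-whole simple block (s≤s (v≤N m))
      l k (≢-sym (≢-by-value vk<vl)) z≤n (s≤s (subst (_≤ toℕ k) (sym l-left) z≤n)) z≤n ≤-refl)))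
    where
    vk≤ : ∀ i → toℕ i ≤ toℕ k → v k ≤ v i
    vk≤ i i≤k with <-cmp (v i) (v k)
    ... | tri≈ _ vi≡vk _ = ≤-reflexive (sym vi≡vk)
    ... | tri> _ _ vk<vi = <⇒≤ vk<vi
    ... | tri< vi<vk _ _ = ⊥-elim (<-asym vi<vk (band-decreasing i<k vr<vi (<-trans vi<vk vk<vl) vr<vk vk<vl))
      where
      i<k : toℕ i < toℕ k
      i<k = ≤∧≢⇒< i≤k (λ i≡k → ≢-by-value vi<vk (toℕ-injective i≡k))
      vr<vi : v r < v i
      vr<vi = left-strip-above-r i (right-of-l (≢-by-value (<-trans vi<vk vk<vl))) (<-trans i<k k<d)

    not-right-of-k : ∀ i → v k ≤ v i → v i ≤ v m → toℕ k < toℕ i → ⊥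
    not-right-of-k i vk≤vi vi≤vm k<i with <-cmp (v i) (v l)
    ... | tri≈ _ vi≡vl _ = n≮0 (subst (toℕ k <_) (trans (cong toℕ (v-injective vi≡vl)) l-left) k<i)
    ... | tri< vi<vl _ _ = <-asym vk<vi (band-decreasing k<i vr<vk vk<vl (<-trans vr<vk vk<vi) vi<vl)
      where
      vk<vi : v k < v i
      vk<vi = ≤∧≢⇒< vk≤vi (λ vk≡vi → ≢-by-position k<i (v-injective vk≡vi))
    ... | tri> _ _ vl<vi with m≤n⇒m<n∨m≡n vi≤vm
    ...   | inj₂ vi≡vm = <⇒≱ k<i (subst (_≤ toℕ k) (cong toℕ (v-injective (sym vi≡vm))) m≤k)
    ...   | inj₁ vi<vm = no-4231 avoids-4231 m k i r
            (≤∧≢⇒< m≤k (λ m≡k → ≢-by-value (<-trans vk<vl (<-trans vl<vi vi<vm)) (toℕ-injective (sym m≡k))))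
            k<i (to-right (left-of-r (≢-sym (≢-by-value (<-trans vr<vl vl<vi)))))
            vr<vk (<-trans vk<vl vl<vi) vi<vm

    block : IsBlock σ 0 (suc (toℕ k)) (v k) (suc (v m))
    block = record
      { values-of-positions = λ i _ i≤k → vk≤ i (s≤s⁻¹ i≤k) , s≤s (m-highest i (s≤s⁻¹ i≤k))
      ; positions-of-values = λ i vk≤vi vi≤vm → z≤n , s≤s (≮⇒≥ (not-right-of-k i vk≤vi (s≤s⁻¹ vi≤vm)))
      }

  E-empty : ∀ k → ¬ InE k
  E-empty k (u<k , k<N , vr<vk , vk<vl) with Extremal.minimiser v (λ i → toℕ k ≤? toℕ i) k ≤-refl
  ... | m , k≤m , m-lowest =
    <-irrefl (sym (proj₁ (block-is-whole simple block (s≤s (v≤N k))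
      k r (≢-sym (≢-by-value vr<vk)) ≤-refl (s≤s (position≤N k)) (subst (toℕ k ≤_) (sym r-right) (position≤N k))
      (s≤s (≤-reflexive r-right))))) (≤-<-trans z≤n u<k)
    where
    ≤vk : ∀ i → toℕ k ≤ toℕ i → v i ≤ v k
    ≤vk i k≤i with <-cmp (v i) (v k)
    ... | tri≈ _ vi≡vk _ = ≤-reflexive vi≡vk
    ... | tri< vi<vk _ _ = <⇒≤ vi<vk
    ... | tri> _ _ vk<vi = ⊥-elim (<-asym vk<vi (band-decreasing k<i vr<vk vk<vl (<-trans vr<vk vk<vi) vi<vl))
      where
      k<i : toℕ k < toℕ i
      k<i = ≤∧≢⇒< k≤i (λ k≡i → ≢-by-value vk<vi (toℕ-injective k≡i))
      vi<vl : v i < v l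
      vi<vl = right-strip-below-l i (<-trans u<k k<i) (left-of-r (≢-sym (≢-by-value (<-trans vr<vk vk<vi))))

    not-left-of-k : ∀ i → v m ≤ v i → v i ≤ v k → toℕ i < toℕ k → ⊥
    not-left-of-k i vm≤vi vi≤vk i<k with <-cmp (v i) (v r)
    ... | tri≈ _ vi≡vr _ =
          <⇒≱ i<k (subst (toℕ k ≤_) (sym (trans (cong toℕ (v-injective vi≡vr)) r-right)) (position≤N k))
    ... | tri> _ _ vr<vi = <-asym vi<vk (band-decreasing i<k vr<vi (<-trans vi<vk vk<vl) vr<vk vk<vl)
      where
      vi<vk : v i < v k
      vi<vk = ≤∧≢⇒< vi≤vk (λ vi≡vk → ≢-by-position i<k (v-injective vi≡vk))
    ... | tri< vi<vr _ _ with m≤n⇒m<n∨m≡n vm≤vi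
    ...   | inj₂ vm≡vi = <⇒≱ i<k (subst (toℕ k ≤_) (cong toℕ (v-injective vm≡vi)) k≤m)
    ...   | inj₁ vm<vi = no-4231 avoids-4231 l i k m
            (from-left (right-of-l (≢-by-value (<-trans vi<vr vr<vl))))
            i<k (≤∧≢⇒< k≤m (λ k≡m → ≢-by-value (<-trans vm<vi (<-trans vi<vr vr<vk)) (toℕ-injective (sym k≡m))))
            vm<vi (<-trans vi<vr vr<vk) vk<vl

    block : IsBlock σ (toℕ k) (suc N) (v m) (suc (v k))
    block = record
      { values-of-positions = λ i k≤i _ → m-lowest i k≤i , s≤s (≤vk i k≤i)
      ; positions-of-values = λ i vm≤vi vi≤vk →
          ≮⇒≥ (not-left-of-k i vm≤vi (s≤s⁻¹ vi≤vk)) , s≤s (position≤N i)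
      }

  left-strip-in-A : 0 < toℕ i → toℕ i < toℕ d → InA i
  left-strip-in-A {i = i} 0<i i<d with <-cmp (v i) (v l)
  ... | tri< vi<vl _ _ = ⊥-elim (C-empty i (0<i , i<d , left-strip-above-r i 0<i i<d , vi<vl))
  ... | tri≈ _ vi≡vl _ = ⊥-elim (<-irrefl (sym (trans (cong toℕ (v-injective vi≡vl)) l-left)) 0<i)
  ... | tri> _ _ vl<vi = 0<i , i<d , vl<vi , below-u (≢-by-position (<-trans i<d d<u))

  right-strip-in-G : toℕ u < toℕ i → toℕ i < N → InG i
  right-strip-in-G {i = i} u<i i<N with <-cmp (v i) (v r)
  ... | tri< vi<vr _ _ = u<i , i<N , above-d (≢-sym (≢-by-position (<-trans d<u u<i))) , vi<vr
  ... | tri≈ _ vi≡vr _ = ⊥-elim (<-irrefl (trans (cong toℕ (v-injective vi≡vr)) r-right) i<N)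
  ... | tri> _ _ vr<vi = ⊥-elim (E-empty i (u<i , i<N , vr<vi , right-strip-below-l i u<i i<N))

  above-l-in-A∪B : v l < v i → v i < N → InA i ⊎ InB i
  above-l-in-A∪B {i = i} vl<vi vi<N with <-cmp (toℕ i) (toℕ d) | <-cmp (toℕ i) (toℕ u)
  ... | tri< i<d _ _ | _ = inj₁ (left-strip-in-A (right-of-l (≢-sym (≢-by-value vl<vi))) i<d)
  ... | tri≈ _ i≡d _ | _ =
        ⊥-elim (<-asym vl<vi (subst (λ k → v k < v l) (sym (toℕ-injective i≡d)) (<-trans vd<vr vr<vl)))
  ... | tri> _ _ d<i | tri< i<u _ _ = inj₂ (d<i , i<u , vl<vi , vi<N)
  ... | tri> _ _ _ | tri≈ _ i≡u _ = ⊥-elim (<-irrefl (trans (cong v (toℕ-injective i≡u)) u-top) vi<N)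
  ... | tri> _ _ _ | tri> _ _ u<i = ⊥-elim (<-asym vl<vi
        (right-strip-below-l i u<i (left-of-r (≢-sym (≢-by-value (<-trans vr<vl vl<vi))))))

  below-r-in-F∪G : 0 < v i → v i < v r → InF i ⊎ InG i
  below-r-in-F∪G {i = i} 0<vi vi<vr with <-cmp (toℕ i) (toℕ d) | <-cmp (toℕ i) (toℕ u)
  ... | tri< i<d _ _ | _ = ⊥-elim (<-asym vi<vr
        (left-strip-above-r i (right-of-l (≢-by-value (<-trans vi<vr vr<vl))) i<d))
  ... | tri≈ _ i≡d _ | _ = ⊥-elim (<-irrefl (sym (trans (cong v (toℕ-injective i≡d)) d-bottom)) 0<vi)
  ... | tri> _ _ d<i | tri< i<u _ _ = inj₁ (d<i , i<u , 0<vi , vi<vr)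
  ... | tri> _ _ _ | tri≈ _ i≡u _ = ⊥-elim (<-asym vi<vr
        (subst (λ k → v r < v k) (sym (toℕ-injective i≡u)) (<-trans vr<vl vl<vu)))
  ... | tri> _ _ _ | tri> _ _ u<i = inj₂ (right-strip-in-G u<i (left-of-r (≢-by-value vi<vr)))

  cover : ∀ i → toℕ i ≢ 0 → toℕ i ≢ N → toℕ i ≢ toℕ u → toℕ i ≢ toℕ d →
          InA i ⊎ InB i ⊎ InD i ⊎ InF i ⊎ InG i
  cover i i≢0 i≢N i≢u i≢d with <-cmp (toℕ i) (toℕ d) | <-cmp (toℕ i) (toℕ u)
  ... | tri< i<d _ _ | _ = inj₁ (left-strip-in-A (n≢0⇒n>0 i≢0) i<d)
  ... | tri≈ _ i≡d _ | _ = ⊥-elim (i≢d i≡d)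
  ... | tri> _ _ _ | tri≈ _ i≡u _ = ⊥-elim (i≢u i≡u)
  ... | tri> _ _ _ | tri> _ _ u<i =
        inj₂ (inj₂ (inj₂ (inj₂ (right-strip-in-G u<i (≤∧≢⇒< (position≤N i) i≢N)))))
  ... | tri> _ _ d<i | tri< i<u _ _ with <-cmp (v i) (v r) | <-cmp (v i) (v l)
  ...   | tri< vi<vr _ _ | _ = inj₂ (inj₂ (inj₂ (inj₁
          (d<i , i<u , above-d (λ i≡d → i≢d (cong toℕ i≡d)) , vi<vr))))
  ...   | tri≈ _ vi≡vr _ | _ = ⊥-elim (i≢N (trans (cong toℕ (v-injective vi≡vr)) r-right))
  ...   | tri> _ _ _ | tri≈ _ vi≡vl _ = ⊥-elim (i≢0 (trans (cong toℕ (v-injective vi≡vl)) l-left))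
  ...   | tri> _ _ vr<vi | tri< vi<vl _ _ = inj₂ (inj₂ (inj₁ (d<i , i<u , vr<vi , vi<vl)))
  ...   | tri> _ _ _ | tri> _ _ vl<vi = inj₂ (inj₁
          (d<i , i<u , vl<vi , below-u (λ i≡u → i≢u (cong toℕ i≡u))))

  BU-increasing : IncreasingOn BU
  BU-increasing i j (inj₁ (d<i , _ , _ , _)) (inj₁ (_ , _ , vl<vj , _)) i<j with <-cmp (v i) (v j)
  ... | tri< vi<vj _ _ = vi<vj
  ... | tri≈ _ vi≡vj _ = ⊥-elim (≢-by-position i<j (v-injective vi≡vj))
  ... | tri> _ _ vj<vi = ⊥-elim (no-2143 avoids-2143 l d i j l<d d<i i<j (<-trans vd<vr vr<vl) vl<vj vj<vi)
  BU-increasing i j (inj₁ (_ , _ , _ , vi<N)) (inj₂ j≡u) _ =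
    subst (λ k → v i < v k) (sym (toℕ-injective j≡u)) (to-top vi<N)
  BU-increasing i j (inj₂ i≡u) (inj₁ (_ , j<u , _ , _)) i<j = ⊥-elim (<-asym j<u (subst (_< toℕ j) i≡u i<j))
  BU-increasing i j (inj₂ i≡u) (inj₂ j≡u) i<j = ⊥-elim (<-irrefl (trans i≡u (sym j≡u)) i<j)

  D-decreasing : DecreasingOn InD
  D-decreasing i j (_ , _ , vr<vi , vi<vl) (_ , _ , vr<vj , vj<vl) i<j =
    band-decreasing i<j vr<vi vi<vl vr<vj vj<vl

  Fd-increasing : IncreasingOn Fd
  Fd-increasing i j (inj₁ (_ , _ , _ , vi<vr)) (inj₁ (_ , j<u , _ , _)) i<j with <-cmp (v i) (v j)
  ... | tri< vi<vj _ _ = vi<vj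
  ... | tri≈ _ vi≡vj _ = ⊥-elim (≢-by-position i<j (v-injective vi≡vj))
  ... | tri> _ _ vj<vi = ⊥-elim (no-2143 avoids-2143 i j u r i<j j<u u<r vj<vi vi<vr (<-trans vr<vl vl<vu))
  Fd-increasing i j (inj₂ i≡d) (inj₁ (_ , _ , 0<vj , _)) _ =
    subst (λ k → v k < v j) (sym (toℕ-injective i≡d)) (from-bottom 0<vj)
  Fd-increasing i j (inj₁ (d<i , _ , _ , _)) (inj₂ j≡d) i<j = ⊥-elim (<-asym d<i (subst (toℕ i <_) j≡d i<j))
  Fd-increasing i j (inj₂ i≡d) (inj₂ j≡d) i<j = ⊥-elim (<-irrefl (trans i≡d (sym j≡d)) i<j)

  BU? : Decidable BU
  BU? i = ((toℕ d <? toℕ i) ×-dec (toℕ i <? toℕ u) ×-dec (v l <? v i) ×-dec (v i <? N)) ⊎-dec (toℕ i ≟ toℕ u)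

  Fd? : Decidable Fd
  Fd? i = ((toℕ d <? toℕ i) ×-dec (toℕ i <? toℕ u) ×-dec (0 <? v i) ×-dec (v i <? v r)) ⊎-dec (toℕ i ≟ toℕ d)

  InA? : Decidable InA
  InA? i = (0 <? toℕ i) ×-dec (toℕ i <? toℕ d) ×-dec (v l <? v i) ×-dec (v i <? N)

  InG? : Decidable InG
  InG? i = (toℕ u <? toℕ i) ×-dec (toℕ i <? N) ×-dec (0 <? v i) ×-dec (v i <? v r)

  BU-right-of-d : BU i → toℕ d < toℕ i
  BU-right-of-d (inj₁ (d<i , _)) = d<i
  BU-right-of-d (inj₂ i≡u) = subst (toℕ d <_) (sym i≡u) d<u

  BU-left-of-r : BU i → toℕ i < toℕ r
  BU-left-of-r (inj₁ (_ , i<u , _)) = <-trans i<u u<r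
  BU-left-of-r (inj₂ i≡u) = subst (_< toℕ r) (sym i≡u) u<r

  BU-above-l : BU i → v l < v i
  BU-above-l (inj₁ (_ , _ , vl<vi , _)) = vl<vi
  BU-above-l (inj₂ i≡u) = subst (λ k → v l < v k) (sym (toℕ-injective i≡u)) vl<vu

  Fd-right-of-l : Fd i → toℕ l < toℕ i
  Fd-right-of-l (inj₁ (d<i , _)) = <-trans l<d d<i
  Fd-right-of-l (inj₂ i≡d) = subst (toℕ l <_) (sym i≡d) l<d

  Fd-left-of-u : Fd i → toℕ i < toℕ u
  Fd-left-of-u (inj₁ (_ , i<u , _)) = i<u
  Fd-left-of-u (inj₂ i≡d) = subst (_< toℕ u) (sym i≡d) d<u

  Fd-below-r : Fd i → v i < v r
  Fd-below-r (inj₁ (_ , _ , _ , vi<vr)) = vi<vr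
  Fd-below-r (inj₂ i≡d) = subst (λ k → v k < v r) (sym (toℕ-injective i≡d)) vd<vr

  one-BU-below-A : ∀ a b b′ → InA a → BU b → BU b′ → v b < v a → v b′ < v a → b ≡ b′
  one-BU-below-A a b b′ (_ , a<d , _) BU-b BU-b′ vb<va vb′<va with <-cmp (toℕ b) (toℕ b′)
  ... | tri≈ _ b≡b′ _ = toℕ-injective b≡b′
  ... | tri< b<b′ _ _ = ⊥-elim (no-4231 avoids-4231 a b b′ r (<-trans a<d (BU-right-of-d BU-b)) b<b′
        (BU-left-of-r BU-b′) (<-trans vr<vl (BU-above-l BU-b)) (BU-increasing b b′ BU-b BU-b′ b<b′) vb′<va)
  ... | tri> _ _ b′<b = ⊥-elim (no-4231 avoids-4231 a b′ b r (<-trans a<d (BU-right-of-d BU-b′)) b′<b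
        (BU-left-of-r BU-b) (<-trans vr<vl (BU-above-l BU-b′)) (BU-increasing b′ b BU-b′ BU-b b′<b) vb<va)

  one-Fd-above-G : ∀ g f f′ → InG g → Fd f → Fd f′ → v g < v f → v g < v f′ → f ≡ f′
  one-Fd-above-G g f f′ (u<g , _) Fd-f Fd-f′ vg<vf vg<vf′ with <-cmp (toℕ f) (toℕ f′)
  ... | tri≈ _ f≡f′ _ = toℕ-injective f≡f′
  ... | tri< f<f′ _ _ = ⊥-elim (no-4231 avoids-4231 l f f′ g (Fd-right-of-l Fd-f) f<f′
        (<-trans (Fd-left-of-u Fd-f′) u<g) vg<vf (Fd-increasing f f′ Fd-f Fd-f′ f<f′) (<-trans (Fd-below-r Fd-f′) vr<vl))
  ... | tri> _ _ f′<f = ⊥-elim (no-4231 avoids-4231 l f′ f g (Fd-right-of-l Fd-f′) f′<f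
        (<-trans (Fd-left-of-u Fd-f) u<g) vg<vf′ (Fd-increasing f′ f Fd-f′ Fd-f f′<f) (<-trans (Fd-below-r Fd-f) vr<vl))

  no-BU-between-A : ∀ x y b → InA x → InA y → BU b → toℕ x < toℕ y → v y < v b → v b < v x → ⊥
  no-BU-between-A x y b _ (_ , y<d , vl<vy , _) BU-b x<y vy<vb vb<vx = no-4231 avoids-4231 x y b r
    x<y (<-trans y<d (BU-right-of-d BU-b)) (BU-left-of-r BU-b) (<-trans vr<vl vl<vy) vy<vb vb<vx

  no-Fd-between-G : ∀ x y f → InG x → InG y → Fd f → toℕ x < toℕ y → v y < v f → v f < v x → ⊥
  no-Fd-between-G x y f (u<x , _ , _ , vx<vr) _ Fd-f x<y vy<vf vf<vx = no-4231 avoids-4231 l f x y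
    (Fd-right-of-l Fd-f) (<-trans (Fd-left-of-u Fd-f) u<x) x<y vy<vf vf<vx (<-trans vx<vr vr<vl)

  module CellA (b₁ : Fin (suc N)) (BU-b₁ : BU b₁) (b₁-lowest : ∀ m → BU m → v b₁ ≤ v m)
               (a* : Fin (suc N)) (0<a* : 0 < toℕ a*) (a*<d : toℕ a* < toℕ d) (vl<va* : v l < v a*) (va*<N : v a* < N)
               (a*-highest : ∀ i → InA i → v i ≤ v a*) where

    A-a* : InA a*
    A-a* = 0<a* , a*<d , vl<va* , va*<N

    b₁<a* : v b₁ < v a*
    b₁<a* = ≰⇒> a*≰b₁
      where
      a*≰b₁ : ¬ v a* ≤ v b₁
      a*≰b₁ a*≤b₁ = <-asym (<-trans d<u u<N) (proj₂ (block-is-whole simple block (s≤s (v≤N a*))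
        l a* (≢-by-value vl<va*) z≤n l<d z≤n a*<d))
        where
        in-cell : ∀ i → toℕ i < toℕ d → v l ≤ v i × v i ≤ v a*
        in-cell i i<d with toℕ i ≟ 0
        ... | yes i≡0 = subst (λ k → v l ≤ v k × v k ≤ v a*) (sym (l-unique i≡0)) (≤-refl , <⇒≤ vl<va*)
        ... | no i≢0 with left-strip-in-A (n≢0⇒n>0 i≢0) i<d
        ...   | A-i@(_ , _ , vl<vi , _) = <⇒≤ vl<vi , a*-highest i A-i

        left-of-d : ∀ i → v l ≤ v i → v i ≤ v a* → toℕ i < toℕ d
        left-of-d i vl≤vi vi≤va* with m≤n⇒m<n∨m≡n vl≤vi
        ... | inj₂ vl≡vi = subst (λ k → toℕ k < toℕ d) (v-injective vl≡vi) l<d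
        ... | inj₁ vl<vi with above-l-in-A∪B vl<vi (≤-<-trans vi≤va* va*<N)
        ...   | inj₁ (_ , i<d , _) = i<d
        ...   | inj₂ B-i = subst (λ k → toℕ k < toℕ d)
                  (sym (v-injective (≤-antisym vi≤va* (≤-trans a*≤b₁ (b₁-lowest i (inj₁ B-i)))))) a*<d

        block : IsBlock σ 0 (toℕ d) (v l) (suc (v a*))
        block = record
          { values-of-positions = λ i _ i<d → proj₁ (in-cell i i<d) , s≤s (proj₂ (in-cell i i<d))
          ; positions-of-values = λ i vl≤vi vi≤va* → z≤n , left-of-d i vl≤vi (s≤s⁻¹ vi≤va*)
          }

    A-above-b₁ : ∀ x → InA x → v b₁ < v x
    A-above-b₁ x A-x@(_ , x<d , vl<vx , _) with <-cmp (v b₁) (v x)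
    ... | tri< vb₁<vx _ _ = vb₁<vx
    ... | tri≈ _ vb₁≡vx _ = ⊥-elim (≢-by-position (<-trans x<d (BU-right-of-d BU-b₁)) (sym (v-injective vb₁≡vx)))
    ... | tri> _ _ vx<vb₁ with Extremal.maximiser toℕ (λ i → InA? i ×-dec (v i <? v b₁)) x (A-x , vx<vb₁)
    ...   | y , (A-y@(_ , y<d , _) , vy<vb₁) , y-rightmost =
      ⊥-elim (<⇒≱ (<-trans y<d (<-trans d<u u<N)) (s≤s⁻¹ (proj₂ (block-is-whole simple block
        (m≤n⇒m≤1+n (v≤N b₁)) l x (≢-by-value vl<vx)
        z≤n (s≤s (subst (_≤ toℕ y) (sym l-left) z≤n)) z≤n (s≤s (y-rightmost x (A-x , vx<vb₁)))))))
      where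
      below-b₁ : ∀ i → InA i → toℕ i ≤ toℕ y → v i < v b₁
      below-b₁ i A-i@(_ , i<d , _) i≤y with <-cmp (v i) (v b₁)
      ... | tri< vi<vb₁ _ _ = vi<vb₁
      ... | tri≈ _ vi≡vb₁ _ = ⊥-elim (≢-by-position (<-trans i<d (BU-right-of-d BU-b₁)) (v-injective vi≡vb₁))
      ... | tri> _ _ vb₁<vi with m≤n⇒m<n∨m≡n i≤y
      ...   | inj₂ i≡y = ⊥-elim (<-asym vy<vb₁ (subst (λ k → v b₁ < v k) (toℕ-injective i≡y) vb₁<vi))
      ...   | inj₁ i<y = ⊥-elim (no-BU-between-A i y b₁ A-i A-y BU-b₁ i<y vy<vb₁ vb₁<vi)

      in-cell : ∀ i → toℕ i ≤ toℕ y → v l ≤ v i × v i < v b₁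
      in-cell i i≤y with toℕ i ≟ 0
      ... | yes i≡0 = subst (λ k → v l ≤ v k × v k < v b₁) (sym (l-unique i≡0)) (≤-refl , BU-above-l BU-b₁)
      ... | no i≢0 with left-strip-in-A (n≢0⇒n>0 i≢0) (≤-<-trans i≤y y<d)
      ...   | A-i@(_ , _ , vl<vi , _) = <⇒≤ vl<vi , below-b₁ i A-i i≤y

      left-of-y : ∀ i → v l ≤ v i → v i < v b₁ → toℕ i ≤ toℕ y
      left-of-y i vl≤vi vi<vb₁ with m≤n⇒m<n∨m≡n vl≤vi
      ... | inj₂ vl≡vi = subst (λ k → toℕ k ≤ toℕ y) (v-injective vl≡vi) (subst (_≤ toℕ y) (sym l-left) z≤n)
      ... | inj₁ vl<vi with above-l-in-A∪B vl<vi (<-trans vi<vb₁ (<-trans b₁<a* va*<N))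
      ...   | inj₁ A-i = y-rightmost i (A-i , vi<vb₁)
      ...   | inj₂ B-i = ⊥-elim (<⇒≱ vi<vb₁ (b₁-lowest i (inj₁ B-i)))

      block : IsBlock σ 0 (suc (toℕ y)) (v l) (v b₁)
      block = record
        { values-of-positions = λ i _ i≤y → in-cell i (s≤s⁻¹ i≤y)
        ; positions-of-values = λ i vl≤vi vi<vb₁ → z≤n , s≤s (left-of-y i vl≤vi vi<vb₁)
        }

    A-unique : AtMostOne InA
    A-unique i j A-i@(0<i , i<d , _) A-j@(0<j , j<d , _) with i ≟ᶠ j
    ... | yes i≡j = i≡j
    ... | no i≢j = ⊥-elim (1+n≢0 (proj₁ (block-is-whole simple block (s≤s (v≤N a*)) i j i≢j 0<i i<d 0<j j<d)))
      where
      in-A : ∀ k → v b₁ < v k → v k ≤ v a* → 0 < toℕ k × toℕ k < toℕ d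
      in-A k vb₁<vk vk≤va* with above-l-in-A∪B (<-trans (BU-above-l BU-b₁) vb₁<vk) (≤-<-trans vk≤va* va*<N)
      ... | inj₁ (0<k , k<d , _) = 0<k , k<d
      ... | inj₂ B-k with m≤n⇒m<n∨m≡n vk≤va*
      ...   | inj₂ vk≡va* = subst (λ m → 0 < toℕ m × toℕ m < toℕ d) (sym (v-injective vk≡va*)) (0<a* , a*<d)
      ...   | inj₁ vk<va* =
              ⊥-elim (<-irrefl (cong v (sym (one-BU-below-A a* k b₁ A-a* (inj₁ B-k) BU-b₁ vk<va* b₁<a*))) vb₁<vk)

      block : IsBlock σ 1 (toℕ d) (suc (v b₁)) (suc (v a*))
      block = record
        { values-of-positions = λ k 0<k k<d →
            let A-k = left-strip-in-A 0<k k<d in A-above-b₁ k A-k , s≤s (a*-highest k A-k)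
        ; positions-of-values = λ k vb₁<vk vk≤va* → in-A k vb₁<vk (s≤s⁻¹ vk≤va*)
        }

    A-between : BetweenTwoSmallest BU (v a*)
    A-between with Extremal.minimiser v (λ m → BU? m ×-dec (v a* <? v m)) u (inj₂ refl , to-top va*<N)
    ... | k , (BU-k , va*<vk) , k-lowest =
      b₁ , k , BU-b₁ , BU-k , ≢-by-value (<-trans b₁<a* va*<vk) , b₁-lowest , next-lowest , b₁<a* , va*<vk
      where
      next-lowest : ∀ m → BU m → m ≢ b₁ → v k ≤ v m
      next-lowest m BU-m m≢b₁ with <-cmp (v m) (v a*)
      ... | tri< vm<va* _ _ = ⊥-elim (m≢b₁ (one-BU-below-A a* m b₁ A-a* BU-m BU-b₁ vm<va* b₁<a*))
      ... | tri≈ _ vm≡va* _ = ⊥-elim (≢-by-position (<-trans a*<d (BU-right-of-d BU-m)) (sym (v-injective vm≡va*)))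
      ... | tri> _ _ va*<vm = k-lowest m (BU-m , va*<vm)

  cell-A : ∀ i → InA i → AtMostOne InA × BetweenTwoSmallest BU (v i)
  cell-A i A-i with Extremal.minimiser v BU? u (inj₂ refl) | Extremal.maximiser v InA? i A-i
  ... | b₁ , BU-b₁ , b₁-lowest | a* , (0<a* , a*<d , vl<va* , va*<N) , a*-highest =
    A-unique , subst (BetweenTwoSmallest BU) (cong v (A-unique a* i A-a* A-i)) A-between
    where open CellA b₁ BU-b₁ b₁-lowest a* 0<a* a*<d vl<va* va*<N a*-highest

  module CellG (f₁ : Fin (suc N)) (Fd-f₁ : Fd f₁) (f₁-highest : ∀ m → Fd m → v m ≤ v f₁)
               (g* : Fin (suc N)) (u<g* : toℕ u < toℕ g*) (g*<N : toℕ g* < N) (0<vg* : 0 < v g*) (vg*<vr : v g* < v r)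
               (g*-lowest : ∀ i → InG i → v g* ≤ v i) where

    G-g* : InG g*
    G-g* = u<g* , g*<N , 0<vg* , vg*<vr

    g*<f₁ : v g* < v f₁
    g*<f₁ = ≰⇒> f₁≰g*
      where
      f₁≰g* : ¬ v f₁ ≤ v g*
      f₁≰g* f₁≤g* = 1+n≢0 (proj₁ (block-is-whole simple block (s≤s (v≤N r))
        g* r (≢-by-value vg*<vr) u<g* (s≤s (position≤N g*)) u<r (s≤s (≤-reflexive r-right))))
        where
        in-cell : ∀ i → toℕ u < toℕ i → v g* ≤ v i × v i ≤ v r
        in-cell i u<i with toℕ i ≟ N
        ... | yes i≡N = subst (λ k → v g* ≤ v k × v k ≤ v r) (sym (r-unique i≡N)) (<⇒≤ vg*<vr , ≤-refl)
        ... | no i≢N with right-strip-in-G u<i (≤∧≢⇒< (position≤N i) i≢N)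
        ...   | G-i@(_ , _ , _ , vi<vr) = g*-lowest i G-i , <⇒≤ vi<vr

        right-of-u : ∀ i → v g* ≤ v i → v i ≤ v r → toℕ u < toℕ i
        right-of-u i vg*≤vi vi≤vr with m≤n⇒m<n∨m≡n vi≤vr
        ... | inj₂ vi≡vr = subst (λ k → toℕ u < toℕ k) (sym (v-injective vi≡vr)) u<r
        ... | inj₁ vi<vr with below-r-in-F∪G (<-≤-trans 0<vg* vg*≤vi) vi<vr
        ...   | inj₂ (u<i , _) = u<i
        ...   | inj₁ F-i = subst (λ k → toℕ u < toℕ k)
                  (v-injective (≤-antisym vg*≤vi (≤-trans (f₁-highest i (inj₁ F-i)) f₁≤g*))) u<g*

        block : IsBlock σ (suc (toℕ u)) (suc N) (v g*) (suc (v r))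
        block = record
          { values-of-positions = λ i u<i _ → proj₁ (in-cell i u<i) , s≤s (proj₂ (in-cell i u<i))
          ; positions-of-values = λ i vg*≤vi vi≤vr → right-of-u i vg*≤vi (s≤s⁻¹ vi≤vr) , s≤s (position≤N i)
          }

    G-below-f₁ : ∀ x → InG x → v x < v f₁
    G-below-f₁ x G-x@(u<x , _ , _ , vx<vr) with <-cmp (v x) (v f₁)
    ... | tri< vx<vf₁ _ _ = vx<vf₁
    ... | tri≈ _ vx≡vf₁ _ = ⊥-elim (≢-by-position (<-trans (Fd-left-of-u Fd-f₁) u<x) (sym (v-injective vx≡vf₁)))
    ... | tri> _ _ vf₁<vx with Extremal.minimiser toℕ (λ i → InG? i ×-dec (v f₁ <? v i)) x (G-x , vf₁<vx)
    ...   | y , (G-y@(u<y , _) , vf₁<vy) , y-leftmost =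
      ⊥-elim (<-irrefl (sym (proj₁ (block-is-whole simple block (s≤s (v≤N r))
        x r (≢-by-value vx<vr) (y-leftmost x (G-x , vf₁<vx)) (s≤s (position≤N x))
        (subst (toℕ y ≤_) (sym r-right) (position≤N y)) (s≤s (≤-reflexive r-right))))) (≤-<-trans z≤n u<y))
      where
      above-f₁ : ∀ i → InG i → toℕ y ≤ toℕ i → v f₁ < v i
      above-f₁ i G-i@(u<i , _) y≤i with <-cmp (v f₁) (v i)
      ... | tri< vf₁<vi _ _ = vf₁<vi
      ... | tri≈ _ vf₁≡vi _ = ⊥-elim (≢-by-position (<-trans (Fd-left-of-u Fd-f₁) u<i) (v-injective vf₁≡vi))
      ... | tri> _ _ vi<vf₁ with m≤n⇒m<n∨m≡n y≤i
      ...   | inj₂ y≡i = ⊥-elim (<-asym vi<vf₁ (subst (λ k → v f₁ < v k) (toℕ-injective y≡i) vf₁<vy))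
      ...   | inj₁ y<i = ⊥-elim (no-Fd-between-G y i f₁ G-y G-i Fd-f₁ y<i vi<vf₁ vf₁<vy)

      in-cell : ∀ i → toℕ y ≤ toℕ i → v f₁ < v i × v i ≤ v r
      in-cell i y≤i with toℕ i ≟ N
      ... | yes i≡N = subst (λ k → v f₁ < v k × v k ≤ v r) (sym (r-unique i≡N)) (Fd-below-r Fd-f₁ , ≤-refl)
      ... | no i≢N with right-strip-in-G (<-≤-trans u<y y≤i) (≤∧≢⇒< (position≤N i) i≢N)
      ...   | G-i@(_ , _ , _ , vi<vr) = above-f₁ i G-i y≤i , <⇒≤ vi<vr

      right-of-y : ∀ i → v f₁ < v i → v i ≤ v r → toℕ y ≤ toℕ i
      right-of-y i vf₁<vi vi≤vr with m≤n⇒m<n∨m≡n vi≤vr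
      ... | inj₂ vi≡vr = subst (λ k → toℕ y ≤ toℕ k) (sym (v-injective vi≡vr))
                           (subst (toℕ y ≤_) (sym r-right) (position≤N y))
      ... | inj₁ vi<vr with below-r-in-F∪G (≤-<-trans z≤n vf₁<vi) vi<vr
      ...   | inj₂ G-i = y-leftmost i (G-i , vf₁<vi)
      ...   | inj₁ F-i = ⊥-elim (<⇒≱ vf₁<vi (f₁-highest i (inj₁ F-i)))

      block : IsBlock σ (toℕ y) (suc N) (suc (v f₁)) (suc (v r))
      block = record
        { values-of-positions = λ i y≤i _ → proj₁ (in-cell i y≤i) , s≤s (proj₂ (in-cell i y≤i))
        ; positions-of-values = λ i vf₁<vi vi≤vr → right-of-y i vf₁<vi (s≤s⁻¹ vi≤vr) , s≤s (position≤N i)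
        }

    G-unique : AtMostOne InG
    G-unique i j (u<i , i<N , _) (u<j , j<N , _) with i ≟ᶠ j
    ... | yes i≡j = i≡j
    ... | no i≢j = ⊥-elim (<-irrefl refl (proj₂ (block-is-whole simple block (m≤n⇒m≤1+n (v≤N f₁))
                     i j i≢j u<i i<N u<j j<N)))
      where
      in-G : ∀ k → v g* ≤ v k → v k < v f₁ → toℕ u < toℕ k × toℕ k < N
      in-G k vg*≤vk vk<vf₁ with below-r-in-F∪G (<-≤-trans 0<vg* vg*≤vk) (<-trans vk<vf₁ (Fd-below-r Fd-f₁))
      ... | inj₂ (u<k , k<N , _) = u<k , k<N
      ... | inj₁ F-k with m≤n⇒m<n∨m≡n vg*≤vk
      ...   | inj₂ vg*≡vk = subst (λ m → toℕ u < toℕ m × toℕ m < N) (v-injective vg*≡vk) (u<g* , g*<N)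
      ...   | inj₁ vg*<vk =
              ⊥-elim (<-irrefl (cong v (one-Fd-above-G g* k f₁ G-g* (inj₁ F-k) Fd-f₁ vg*<vk g*<f₁)) vk<vf₁)

      block : IsBlock σ (suc (toℕ u)) N (v g*) (v f₁)
      block = record
        { values-of-positions = λ k u<k k<N → let G-k = right-strip-in-G u<k k<N in g*-lowest k G-k , G-below-f₁ k G-k
        ; positions-of-values = in-G
        }

    G-between : BetweenTwoLargest Fd (v g*)
    G-between with Extremal.maximiser v (λ m → Fd? m ×-dec (v m <? v g*)) d (inj₂ refl , from-bottom 0<vg*)
    ... | k , (Fd-k , vk<vg*) , k-highest =
      f₁ , k , Fd-f₁ , Fd-k , ≢-sym (≢-by-value (<-trans vk<vg* g*<f₁))
      , f₁-highest , next-highest , vk<vg* , g*<f₁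
      where
      next-highest : ∀ m → Fd m → m ≢ f₁ → v m ≤ v k
      next-highest m Fd-m m≢f₁ with <-cmp (v m) (v g*)
      ... | tri< vm<vg* _ _ = k-highest m (Fd-m , vm<vg*)
      ... | tri≈ _ vm≡vg* _ = ⊥-elim (≢-by-position (<-trans (Fd-left-of-u Fd-m) u<g*) (v-injective vm≡vg*))
      ... | tri> _ _ vg*<vm = ⊥-elim (m≢f₁ (one-Fd-above-G g* m f₁ G-g* Fd-m Fd-f₁ vg*<vm g*<f₁))

  cell-G : ∀ i → InG i → AtMostOne InG × BetweenTwoLargest Fd (v i)
  cell-G i G-i with Extremal.maximiser v Fd? d (inj₂ refl) | Extremal.minimiser v InG? i G-i
  ... | f₁ , Fd-f₁ , f₁-highest | g* , (u<g* , g*<N , 0<vg* , vg*<vr) , g*-lowest =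
    G-unique , subst (BetweenTwoLargest Fd) (cong v (G-unique g* i G-g* G-i)) G-between
    where open CellG f₁ Fd-f₁ f₁-highest g* u<g* g*<N 0<vg* vg*<vr g*-lowest

  shape : Shape
  shape = (0<d , d<u , u<N , 0<vr , vr<vl , vl<N)
        , cover , C-empty , E-empty , BU-increasing , D-decreasing , Fd-increasing
        , (λ i j A-i → proj₁ (cell-A i A-i) i j A-i) , (λ i A-i → proj₂ (cell-A i A-i))
        , (λ i j G-i → proj₁ (cell-G i G-i) i j G-i) , (λ i G-i → proj₂ (cell-G i G-i))

corollary4 : (n : ℕ) → 4 ≤ n → (π : Permutation′ n) →
    Simple (perm π) → Avoids (perm π) pat2143 → Avoids (perm π) pat4231 →
    ((l r u d : Fin n) → toℕ l ≡ 0 → toℕ r ≡ n ∸ 1 →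
      toℕ (perm π u) ≡ n ∸ 1 → toℕ (perm π d) ≡ 0 →
      FourPointsForm (perm π) l r u d pat2413) →
    (l r u d : Fin n) → toℕ l ≡ 0 → toℕ r ≡ n ∸ 1 →
      toℕ (inv π u) ≡ n ∸ 1 → toℕ (inv π d) ≡ 0 →
      Regions.Shape (inv π) (toℕ (inv π l)) (toℕ (inv π r)) (toℕ d) (toℕ u)
corollary4 (suc N) _ π simple avoids-2143 avoids-4231 corners l r u d l-left r-right u-top d-bottom
  with Inverse.corners-3142 π corners l r u d l-left r-right u-top d-bottom
... | (l<d , d<u , u<r) , (vd<vr , vr<vl , vl<vu) =
  Cells.shape π simple avoids-2143 avoids-4231 l r u d l-left r-right u-top d-bottom l<d d<u u<r vd<vr vr<vl vl<vu
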